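{- Let $G$ be a finite directed multigraph without loops on vertex set $\{1,\dots,n+1\}$ having a global sink at vertex $n+1$, with reduced Laplacian $\Delta$. Let $\mathbf a^*$ be a critical configuration. Then for every stable configuration $\mathbf a$ linearly equivalent to $\mathbf a^*$ we have $\mathbf a\preceq_{\mathrm{CFG}}\mathbf a^*$, i.e. $\mathbf a\Delta^{ -1}\preceq\mathbf a^*\Delta^{ -1}$ componentwise; moreover the inequality is strict ($\mathbf a\Delta^{ -1}\ne\mathbf a^*\Delta^{ -1}$) when $\mathbf a\ne\mathbf a^*$. In other words, the critical configuration is the greatest element, with respect to $\preceq_{\mathrm{CFG}}$ (equivalently, the greatest energy vector in the containment order), among the stable configurations of its equivalence class.
   Context: $G=(V,E)$ is a directed multigraph without loops, $V=\{1,\dots,n+1\}$; $d^+_i$ is the out-degree of $i$ and $e_{i,j}$ the number of edges from $i$ to $j$. Vertex $n+1$ is a global sink: it has no out-going edges and every other vertex has a directed path to it. The reduced Laplacian $\Delta\in\mathbb Z^{n\times n}$ has $\Delta_{ii}=d^+_i$ and $\Delta_{ij}=-e_{i,j}$ for $i\ne j$ ($i,j\le n$); it is invertible. $\Delta_i$ is its $i$-th row. Vectors are row vectors. A configuration is a vector in $\mathbb Z^n$. Two configurations $\mathbf a,\mathbf b$ are linearly equivalent if $\mathbf b=\mathbf a-\sigma\Delta$ for some $\sigma\in\mathbb Z^n$. Vertex $i$ is active in $\mathbf a$ if $a_i\ge d^+_i$; firing it gives $\mathbf a-\Delta_i$. A firing sequence is legal if each fired vertex is active when it fires. A stable configuration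 is a non-negative configuration with no active vertex. For non-negative $\mathbf a$, $\mathbf a^\circ$ denotes the unique stable configuration reachable from $\mathbf a$ by a legal firing sequence. A non-negative configuration $\mathbf a$ is critical if for every configuration $\mathbf b$ there exists a non-negative configuration $\mathbf c$ with $\mathbf b+\mathbf c$ non-negative and $\mathbf a=(\mathbf b+\mathbf c)^\circ$. Containment order: $a\preceq b$ iff $a_i\le b_i$ for all $i$. The energy vector of a configuration $\mathbf a$ is $\mathbf a\Delta^{ -1}$, and $\mathbf a\preceq_{\mathrm{CFG}}\mathbf b$ means $\mathbf a\Delta^{ -1}\preceq\mathbf b\Delta^{ -1}$. -}

module Defs where

open import Data.Nat as ℕ using (ℕ; zero; suc)
open import Data.Integer as ℤ using (ℤ; +_)
open import Data.Rational as ℚ using (ℚ)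
open import Data.Fin using (Fin; zero; suc; inject₁; fromℕ)
open import Data.Product using (Σ; ∃; ∃-syntax; _×_; _,_)
open import Relation.Binary.PropositionalEquality using (_≡_; _≢_)
open import Relation.Nullary using (¬_)
open import Relation.Nullary.Decidable using (does)
open import Data.Fin using (_≟_)
open import Data.Bool using (if_then_else_)

sumℕ : ∀ {n} → (Fin n → ℕ) → ℕ
sumℕ {zero} f = 0
sumℕ {suc n} f = f zero ℕ.+ sumℕ (λ i → f (suc i))

sumℤ : ∀ {n} → (Fin n → ℤ) → ℤ
sumℤ {zero} f = + 0
sumℤ {suc n} f = f zero ℤ.+ sumℤ (λ i → f (suc i))

sumℚ : ∀ {n} → (Fin n → ℚ) → ℚ
sumℚ {zero} f = ℚ.0ℚ
sumℚ {suc n} f = f zero ℚ.+ sumℚ (λ i → f (suc i))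

-- A directed loopless multigraph on vertices Fin (suc n); the last vertex
-- (fromℕ n, i.e. vertex n+1) is the sink and has no out-going edges, so
-- the edge multiplicities are given only for edges leaving the non-sink
-- vertices Fin n (embedded via inject₁).
Edges : ℕ → Set
Edges n = Fin n → Fin (suc n) → ℕ

Loopless : ∀ {n} → Edges n → Set
Loopless {n} e = ∀ (i : Fin n) → e i (inject₁ i) ≡ 0

data ReachesSink {n} (e : Edges n) : Fin (suc n) → Set where
  atSink : ReachesSink e (fromℕ n)
  step   : ∀ (i : Fin n) (j : Fin (suc n)) → 0 ℕ.< e i j →
           ReachesSink e j → ReachesSink e (inject₁ i)

GlobalSink : ∀ {n} → Edges n → Set
GlobalSink {n} e = ∀ (i : Fin n) → ReachesSink e (inject₁ i)

outdeg : ∀ {n} → Edges n → Fin n → ℕ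
outdeg e i = sumℕ (e i)

Δ : ∀ {n} → Edges n → Fin n → Fin n → ℤ
Δ e i j = if does (i ≟ j) then + outdeg e i else ℤ.- (+ e i (inject₁ j))

Config : ℕ → Set
Config n = Fin n → ℤ

_·Δ[_] : ∀ {n} → Config n → Edges n → Config n
(σ ·Δ[ e ]) j = sumℤ (λ i → σ i ℤ.* Δ e i j)

_·Δℚ[_] : ∀ {n} → (Fin n → ℚ) → Edges n → Fin n → ℚ
(x ·Δℚ[ e ]) j = sumℚ (λ i → x i ℚ.* (Δ e i j ℚ./ 1))

toℚ : ∀ {n} → Config n → Fin n → ℚ
toℚ a i = a i ℚ./ 1

LinEquiv : ∀ {n} → Edges n → Config n → Config n → Set
LinEquiv {n} e a b = ∃[ σ ] (∀ j → b j ≡ a j ℤ.- (σ ·Δ[ e ]) j)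

NonNeg : ∀ {n} → Config n → Set
NonNeg a = ∀ i → + 0 ℤ.≤ a i

Active : ∀ {n} → Edges n → Config n → Fin n → Set
Active e a i = + outdeg e i ℤ.≤ a i

fire : ∀ {n} → Edges n → Config n → Fin n → Config n
fire e a i j = a j ℤ.- Δ e i j

data Legal {n} (e : Edges n) : Config n → Config n → Set where
  done : ∀ {a} → Legal e a a
  fireThen : ∀ {a b} (i : Fin n) → Active e a i → Legal e (fire e a i) b → Legal e a b

Stable : ∀ {n} → Edges n → Config n → Set
Stable e a = NonNeg a × (∀ i → ¬ Active e a i)

-- b is the stabilization b = a° of the non-negative configuration a
-- (the unique stable configuration reachable from a by a legal firing sequence)
IsStabilization : ∀ {n} → Edges n → Config n → Config n → Set
IsStabilization e a b = Legal e a b × Stable e b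

_+ᶜ_ : ∀ {n} → Config n → Config n → Config n
(a +ᶜ b) i = a i ℤ.+ b i

Critical : ∀ {n} → Edges n → Config n → Set
Critical e a = NonNeg a ×
  (∀ b → ∃[ c ] (NonNeg c × NonNeg (b +ᶜ c) × IsStabilization e (b +ᶜ c) a))

_≼_ : ∀ {n} → (Fin n → ℚ) → (Fin n → ℚ) → Set
x ≼ y = ∀ i → x i ℚ.≤ y i

-- x is the energy vector a Δ⁻¹ of a, i.e. x Δ = a (Δ is invertible)
IsEnergy : ∀ {n} → Edges n → Config n → (Fin n → ℚ) → Set
IsEnergy e a x = ∀ j → (x ·Δℚ[ e ]) j ≡ toℚ a j

{-# OPTIONS --safe #-}
module Submission where

-- Criticality writes a* = (a + c)° with c ≥ 0; let τ be the firing vector of this stabilisation,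
-- so a* = a + c − τΔ, and let a = a* − σΔ. The engine of the proof is that Δ⁻¹ is entrywise
-- non-negative: uΔ ≥ 0 forces u ≥ 0, because pairing uΔ with the indicator of {u < 0} shows that
-- no edge leaves this set, which the global sink forbids unless it is empty. Hence (τ + σ)Δ = c
-- gives τ + σ ≥ 0, and the least action principle (a legal firing sequence never fires a vertex
-- more often than a non-negative firing vector leading to a stable configuration) yields
-- a = a* − σ′Δ with σ′ ≥ 0. Then (y − x − σ′)Δ = 0, so y − x ≥ σ′ ≥ 0; equal energies give
-- equal configurations.

open import Algebra using (CommutativeRing)
open import Data.Bool using (true; false; if_then_else_)
open import Data.Fin using (Fin; zero; suc; inject₁; fromℕ; _≟_)
open import Data.Nat as ℕ using (ℕ)
open import Data.Vec.Functional using (Vector)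
open import Relation.Nullary.Decidable using (does)

module RowAction {c ℓ} (R : CommutativeRing c ℓ) where

  open CommutativeRing R hiding (zero)
  open import Algebra.Properties.Ring ring using (-1*x≈-x; -‿distribˡ-*)
  open import Algebra.Properties.Semiring.Sum semiring public
    using (sum; sum-cong-≋; sum-replicate-zero; sum-init-last; ∑-distrib-+; ∑-comm; *-distribˡ-sum; *-distribʳ-sum)
  open import Relation.Binary.Reasoning.Setoid setoid

  private
    variable
      m n : ℕ

  _⊛_ : Vector Carrier m → (Fin m → Fin n → Carrier) → Vector Carrier n
  (x ⊛ M) j = sum (λ i → x i * M i j)

  _⊙_ : (Fin m → Fin n → Carrier) → Vector Carrier n → Vector Carrier m
  (M ⊙ v) i = sum (λ j → M i j * v j)

  unit : Fin n → Vector Carrier n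
  unit i j = if does (i ≟ j) then 1# else 0#

  sum-zero : ∀ n → sum {n} (λ _ → 0#) ≈ 0#
  sum-zero n = sum-replicate-zero n

  sum-δ : (i : Fin n) (f : Vector Carrier n) → sum (λ j → if does (i ≟ j) then f j else 0#) ≈ f i
  sum-δ {ℕ.suc n} zero f = trans (+-congˡ (sum-zero n)) (+-identityʳ (f zero))
  sum-δ (suc i) f = trans (+-identityˡ _) (sum-δ i (λ j → f (suc j)))

  sum-neg : (f : Vector Carrier n) → sum (λ i → - f i) ≈ - sum f
  sum-neg f = begin
    sum (λ i → - f i)       ≈⟨ sum-cong-≋ (λ i → sym (-1*x≈-x (f i))) ⟩
    sum (λ i → - 1# * f i)  ≈⟨ *-distribˡ-sum (- 1#) f ⟨
    - 1# * sum f            ≈⟨ -1*x≈-x (sum f) ⟩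
    - sum f                 ∎

  ⊛-zeroˡ : (M : Fin m → Fin n → Carrier) (j : Fin n) → ((λ _ → 0#) ⊛ M) j ≈ 0#
  ⊛-zeroˡ {m} M j = trans (sum-cong-≋ (λ i → zeroˡ (M i j))) (sum-zero m)

  ⊛-unit : (i : Fin m) (M : Fin m → Fin n → Carrier) (j : Fin n) → (unit i ⊛ M) j ≈ M i j
  ⊛-unit i M j = trans (sum-cong-≋ unit*M) (sum-δ i (λ k → M k j))
    where
    unit*M : ∀ k → unit i k * M k j ≈ (if does (i ≟ k) then M k j else 0#)
    unit*M k with does (i ≟ k)
    ... | true  = *-identityˡ (M k j)
    ... | false = zeroˡ (M k j)

  ⊛-distrib-+ : (x y : Vector Carrier m) (M : Fin m → Fin n → Carrier) (j : Fin n) →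
                ((λ k → x k + y k) ⊛ M) j ≈ (x ⊛ M) j + (y ⊛ M) j
  ⊛-distrib-+ x y M j =
    trans (sum-cong-≋ (λ i → distribʳ (M i j) (x i) (y i))) (∑-distrib-+ (λ i → x i * M i j) (λ i → y i * M i j))

  ⊛-distrib-- : (x y : Vector Carrier m) (M : Fin m → Fin n → Carrier) (j : Fin n) →
                ((λ k → x k - y k) ⊛ M) j ≈ (x ⊛ M) j - (y ⊛ M) j
  ⊛-distrib-- x y M j = begin
    ((λ k → x k - y k) ⊛ M) j                ≈⟨ ⊛-distrib-+ x (λ k → - y k) M j ⟩
    (x ⊛ M) j + sum (λ i → - y i * M i j)    ≈⟨ +-congˡ (sum-cong-≋ (λ i → sym (-‿distribˡ-* (y i) (M i j)))) ⟩
    (x ⊛ M) j + sum (λ i → - (y i * M i j))  ≈⟨ +-congˡ (sum-neg (λ i → y i * M i j)) ⟩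
    (x ⊛ M) j - (y ⊛ M) j                    ∎

  ⊛-⊙-assoc : (x : Vector Carrier m) (M : Fin m → Fin n → Carrier) (v : Vector Carrier n) →
              sum (λ j → (x ⊛ M) j * v j) ≈ sum (λ i → x i * (M ⊙ v) i)
  ⊛-⊙-assoc x M v = begin
    sum (λ j → (x ⊛ M) j * v j)                  ≈⟨ sum-cong-≋ (λ j → *-distribʳ-sum (v j) (λ i → x i * M i j)) ⟩
    sum (λ j → sum (λ i → x i * M i j * v j))    ≈⟨ ∑-comm (λ j i → x i * M i j * v j) ⟩
    sum (λ i → sum (λ j → x i * M i j * v j))    ≈⟨ sum-cong-≋ (λ i → sum-cong-≋ (λ j → *-assoc (x i) (M i j) (v j))) ⟩
    sum (λ i → sum (λ j → x i * (M i j * v j)))  ≈⟨ sum-cong-≋ (λ i → *-distribˡ-sum (x i) (λ j → M i j * v j)) ⟨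
    sum (λ i → x i * (M ⊙ v) i)                  ∎

open import Defs
open import Data.Integer as ℤ using (ℤ; +_)
import Data.Integer.Properties as ℤP
open import Data.Integer.Solver renaming (module +-*-Solver to ℤ-Solver)
import Data.Nat.Properties as ℕP
open import Data.Nat.Coprimality using (1-coprimeTo) renaming (sym to coprime-sym)
open import Data.Product using (∃-syntax; _×_; _,_)
open import Data.Rational as ℚ using (ℚ; mkℚ; 0ℚ; 1ℚ)
import Data.Rational.Properties as ℚP
open import Data.Rational.Solver renaming (module +-*-Solver to ℚ-Solver)
open import Algebra.Properties.Group ℚP.+-0-group using () renaming (∙-cancelʳ to +-cancelʳ)
open import Function using (_∘_)
open import Relation.Binary.PropositionalEquality
open import Relation.Nullary using (¬_; Dec; yes; no; contradiction)

module ℤᴿ = RowAction ℤP.+-*-commutativeRing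
module ℚᴿ = RowAction ℚP.+-*-commutativeRing

private
  variable
    n : ℕ

sumℤ≗sum : (f : Fin n → ℤ) → sumℤ f ≡ ℤᴿ.sum f
sumℤ≗sum {ℕ.zero}  f = refl
sumℤ≗sum {ℕ.suc n} f = cong (ℤ._+_ (f zero)) (sumℤ≗sum (f ∘ suc))

sumℚ≗sum : (f : Fin n → ℚ) → sumℚ f ≡ ℚᴿ.sum f
sumℚ≗sum {ℕ.zero}  f = refl
sumℚ≗sum {ℕ.suc n} f = cong (ℚ._+_ (f zero)) (sumℚ≗sum (f ∘ suc))

sum-mono-≤ : {f g : Fin n → ℚ} → (∀ i → f i ℚ.≤ g i) → ℚᴿ.sum f ℚ.≤ ℚᴿ.sum g
sum-mono-≤ {ℕ.zero}  f≤g = ℚP.≤-refl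
sum-mono-≤ {ℕ.suc n} f≤g = ℚP.+-mono-≤ (f≤g zero) (sum-mono-≤ (f≤g ∘ suc))

sum-nonneg : {f : Fin n → ℚ} → (∀ i → 0ℚ ℚ.≤ f i) → 0ℚ ℚ.≤ ℚᴿ.sum f
sum-nonneg {n} {f} 0≤f = subst (ℚ._≤ ℚᴿ.sum f) (ℚᴿ.sum-zero n) (sum-mono-≤ 0≤f)

sum-nonpos : {f : Fin n → ℚ} → (∀ i → f i ℚ.≤ 0ℚ) → ℚᴿ.sum f ℚ.≤ 0ℚ
sum-nonpos {n} {f} f≤0 = subst (ℚᴿ.sum f ℚ.≤_) (ℚᴿ.sum-zero n) (sum-mono-≤ f≤0)

term≤sum : {f : Fin n → ℚ} → (∀ i → 0ℚ ℚ.≤ f i) → ∀ i → f i ℚ.≤ ℚᴿ.sum f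
term≤sum {f = f} 0≤f i = subst (ℚ._≤ ℚᴿ.sum f) (ℚᴿ.sum-δ i f) (sum-mono-≤ δf≤f)
  where
  δf≤f : ∀ j → (if does (i ≟ j) then f j else 0ℚ) ℚ.≤ f j
  δf≤f j with does (i ≟ j)
  ... | true  = ℚP.≤-refl
  ... | false = 0≤f j

sum≤term : {f : Fin n → ℚ} → (∀ i → f i ℚ.≤ 0ℚ) → ∀ i → ℚᴿ.sum f ℚ.≤ f i
sum≤term {f = f} f≤0 i = subst (ℚᴿ.sum f ℚ.≤_) (ℚᴿ.sum-δ i f) (sum-mono-≤ f≤δf)
  where
  f≤δf : ∀ j → f j ℚ.≤ (if does (i ≟ j) then f j else 0ℚ)
  f≤δf j with does (i ≟ j)
  ... | true  = ℚP.≤-refl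
  ... | false = f≤0 j

sumℤ-nonpos : (f : Fin n → ℤ) → (∀ i → f i ℤ.≤ + 0) → sumℤ f ℤ.≤ + 0
sumℤ-nonpos {ℕ.zero}  f f≤0 = ℤP.≤-refl
sumℤ-nonpos {ℕ.suc n} f f≤0 = ℤP.+-mono-≤ (f≤0 zero) (sumℤ-nonpos (f ∘ suc) (f≤0 ∘ suc))

ℚ[_] : ℤ → ℚ
ℚ[ z ] = z ℚ./ 1

private
  ℚ[]≡mkℚ : ∀ z → ℚ[ z ] ≡ mkℚ z 0 (coprime-sym (1-coprimeTo ℤ.∣ z ∣))
  ℚ[]≡mkℚ z = ℚP.↥p/↧p≡p (mkℚ z 0 _)

ℚ[]-+ : ∀ a b → ℚ[ a ℤ.+ b ] ≡ ℚ[ a ] ℚ.+ ℚ[ b ]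
ℚ[]-+ a b = sym (trans (cong₂ ℚ._+_ (ℚ[]≡mkℚ a) (ℚ[]≡mkℚ b))
  (cong ℚ[_] (cong₂ ℤ._+_ (ℤP.*-identityʳ a) (ℤP.*-identityʳ b))))

ℚ[]-* : ∀ a b → ℚ[ a ℤ.* b ] ≡ ℚ[ a ] ℚ.* ℚ[ b ]
ℚ[]-* a b = sym (cong₂ ℚ._*_ (ℚ[]≡mkℚ a) (ℚ[]≡mkℚ b))

ℚ[]-neg : ∀ z → ℚ[ ℤ.- z ] ≡ ℚ.- ℚ[ z ]
ℚ[]-neg (+ 0)          = refl
ℚ[]-neg z@(ℤ.+[1+ _ ]) = trans (ℚ[]≡mkℚ (ℤ.- z)) (cong ℚ.-_ (sym (ℚ[]≡mkℚ z)))
ℚ[]-neg z@(ℤ.-[1+ _ ]) = trans (ℚ[]≡mkℚ (ℤ.- z)) (cong ℚ.-_ (sym (ℚ[]≡mkℚ z)))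

ℚ[]-- : ∀ a b → ℚ[ a ℤ.- b ] ≡ ℚ[ a ] ℚ.- ℚ[ b ]
ℚ[]-- a b = trans (ℚ[]-+ a (ℤ.- b)) (cong (ℚ._+_ ℚ[ a ]) (ℚ[]-neg b))

ℚ[]-mono-≤ : ∀ {a b} → a ℤ.≤ b → ℚ[ a ] ℚ.≤ ℚ[ b ]
ℚ[]-mono-≤ {a} {b} a≤b = subst₂ ℚ._≤_ (sym (ℚ[]≡mkℚ a)) (sym (ℚ[]≡mkℚ b))
  (ℚ.*≤* (subst₂ ℤ._≤_ (sym (ℤP.*-identityʳ a)) (sym (ℤP.*-identityʳ b)) a≤b))

ℚ[]-cancel-≤ : ∀ {a b} → ℚ[ a ] ℚ.≤ ℚ[ b ] → a ℤ.≤ b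
ℚ[]-cancel-≤ {a} {b} qa≤qb with subst₂ ℚ._≤_ (ℚ[]≡mkℚ a) (ℚ[]≡mkℚ b) qa≤qb
... | ℚ.*≤* a*1≤b*1 = subst₂ ℤ._≤_ (ℤP.*-identityʳ a) (ℤP.*-identityʳ b) a*1≤b*1

ℚ[]-injective : ∀ {a b} → ℚ[ a ] ≡ ℚ[ b ] → a ≡ b
ℚ[]-injective {a} {b} eq = cong ℚ.↥_ (trans (sym (ℚ[]≡mkℚ a)) (trans eq (ℚ[]≡mkℚ b)))

ℚ[]-sumℤ : (f : Fin n → ℤ) → ℚ[ sumℤ f ] ≡ sumℚ (ℚ[_] ∘ f)
ℚ[]-sumℤ {ℕ.zero}  f = refl
ℚ[]-sumℤ {ℕ.suc n} f = trans (ℚ[]-+ (f zero) (sumℤ (f ∘ suc))) (cong (ℚ._+_ ℚ[ f zero ]) (ℚ[]-sumℤ (f ∘ suc)))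

ℚ[]-sumℕ : (f : Fin n → ℕ) → ℚ[ + sumℕ f ] ≡ ℚᴿ.sum (λ i → ℚ[ + f i ])
ℚ[]-sumℕ {ℕ.zero}  f = refl
ℚ[]-sumℕ {ℕ.suc n} f = trans (cong ℚ[_] (ℤP.pos-+ (f zero) _))
  (trans (ℚ[]-+ (+ f zero) (+ sumℕ (f ∘ suc))) (cong (ℚ._+_ ℚ[ + f zero ]) (ℚ[]-sumℕ (f ∘ suc))))

module _ {n} (e : Edges n) where

  Δℚ : Fin n → Fin n → ℚ
  Δℚ i j = ℚ[ Δ e i j ]

  ·Δ≡⊛ : (σ : Config n) (j : Fin n) → (σ ·Δ[ e ]) j ≡ (σ ℤᴿ.⊛ Δ e) j
  ·Δ≡⊛ σ j = sumℤ≗sum (λ i → σ i ℤ.* Δ e i j)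

  ·Δℚ≡⊛ : (x : Fin n → ℚ) (j : Fin n) → (x ·Δℚ[ e ]) j ≡ (x ℚᴿ.⊛ Δℚ) j
  ·Δℚ≡⊛ x j = sumℚ≗sum (λ i → x i ℚ.* Δℚ i j)

  toℚ-·Δ : (σ : Config n) (j : Fin n) → toℚ (σ ·Δ[ e ]) j ≡ (toℚ σ ·Δℚ[ e ]) j
  toℚ-·Δ σ j = begin
    ℚ[ sumℤ (λ i → σ i ℤ.* Δ e i j) ]           ≡⟨ ℚ[]-sumℤ (λ i → σ i ℤ.* Δ e i j) ⟩
    sumℚ (λ i → ℚ[ σ i ℤ.* Δ e i j ])           ≡⟨ sumℚ≗sum (λ i → ℚ[ σ i ℤ.* Δ e i j ]) ⟩
    ℚᴿ.sum (λ i → ℚ[ σ i ℤ.* Δ e i j ])         ≡⟨ ℚᴿ.sum-cong-≋ (λ i → ℚ[]-* (σ i) (Δ e i j)) ⟩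
    (toℚ σ ℚᴿ.⊛ Δℚ) j                           ≡⟨ ·Δℚ≡⊛ (toℚ σ) j ⟨
    (toℚ σ ·Δℚ[ e ]) j                          ∎
    where open ≡-Reasoning

  ·Δ-zero : ∀ j → ((λ _ → + 0) ·Δ[ e ]) j ≡ + 0
  ·Δ-zero j = trans (·Δ≡⊛ (λ _ → + 0) j) (ℤᴿ.⊛-zeroˡ (Δ e) j)

  ·Δ-unit : ∀ i j → (ℤᴿ.unit i ·Δ[ e ]) j ≡ Δ e i j
  ·Δ-unit i j = trans (·Δ≡⊛ (ℤᴿ.unit i) j) (ℤᴿ.⊛-unit i (Δ e) j)

  ·Δ-distrib-+ : ∀ σ τ j → ((σ +ᶜ τ) ·Δ[ e ]) j ≡ (σ ·Δ[ e ]) j ℤ.+ (τ ·Δ[ e ]) j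
  ·Δ-distrib-+ σ τ j = trans (·Δ≡⊛ (σ +ᶜ τ) j)
    (trans (ℤᴿ.⊛-distrib-+ σ τ (Δ e) j) (sym (cong₂ ℤ._+_ (·Δ≡⊛ σ j) (·Δ≡⊛ τ j))))

  ·Δ-distrib-- : ∀ σ τ j → ((λ k → σ k ℤ.- τ k) ·Δ[ e ]) j ≡ (σ ·Δ[ e ]) j ℤ.- (τ ·Δ[ e ]) j
  ·Δ-distrib-- σ τ j = trans (·Δ≡⊛ (λ k → σ k ℤ.- τ k) j)
    (trans (ℤᴿ.⊛-distrib-- σ τ (Δ e) j) (sym (cong₂ ℤ._-_ (·Δ≡⊛ σ j) (·Δ≡⊛ τ j))))

  ·Δℚ-distrib-- : ∀ x y j → ((λ k → x k ℚ.- y k) ·Δℚ[ e ]) j ≡ (x ·Δℚ[ e ]) j ℚ.- (y ·Δℚ[ e ]) j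
  ·Δℚ-distrib-- x y j = trans (·Δℚ≡⊛ (λ k → x k ℚ.- y k) j)
    (trans (ℚᴿ.⊛-distrib-- x y Δℚ j) (sym (cong₂ ℚ._-_ (·Δℚ≡⊛ x j) (·Δℚ≡⊛ y j))))

  Fires : Config n → Config n → Config n → Set
  Fires b σ c = ∀ j → c j ≡ b j ℤ.- (σ ·Δ[ e ]) j

  fires-zero : ∀ b → Fires b (λ _ → + 0) b
  fires-zero b j = sym (trans (cong (ℤ._-_ (b j)) (·Δ-zero j)) (ℤP.+-identityʳ (b j)))

  fire-fires : ∀ b i → Fires b (ℤᴿ.unit i) (fire e b i)
  fire-fires b i j = cong (ℤ._-_ (b j)) (sym (·Δ-unit i j))

  fires-compose : ∀ {b σ c τ d} → Fires b σ c → Fires c τ d → Fires b (σ +ᶜ τ) d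
  fires-compose {b} {σ} {c} {τ} {d} b→c c→d j = begin
    d j                                            ≡⟨ c→d j ⟩
    c j ℤ.- (τ ·Δ[ e ]) j                          ≡⟨ cong (ℤ._- (τ ·Δ[ e ]) j) (b→c j) ⟩
    b j ℤ.- (σ ·Δ[ e ]) j ℤ.- (τ ·Δ[ e ]) j        ≡⟨ regroup (b j) ((σ ·Δ[ e ]) j) ((τ ·Δ[ e ]) j) ⟩
    b j ℤ.- ((σ ·Δ[ e ]) j ℤ.+ (τ ·Δ[ e ]) j)      ≡⟨ cong (ℤ._-_ (b j)) (·Δ-distrib-+ σ τ j) ⟨
    b j ℤ.- ((σ +ᶜ τ) ·Δ[ e ]) j                   ∎
    where
    open ≡-Reasoning
    regroup : ∀ x s t → x ℤ.- s ℤ.- t ≡ x ℤ.- (s ℤ.+ t)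
    regroup = ℤ-Solver.solve 3 (λ x s t → x :- s :- t := x :- (s :+ t)) refl
      where open ℤ-Solver

  fires-cancel : ∀ {b σ c ρ d} → Fires b σ c → Fires b ρ d → Fires c (λ k → ρ k ℤ.- σ k) d
  fires-cancel {b} {σ} {c} {ρ} {d} b→c b→d j = begin
    d j                                            ≡⟨ b→d j ⟩
    b j ℤ.- (ρ ·Δ[ e ]) j                          ≡⟨ regroup (b j) ((σ ·Δ[ e ]) j) ((ρ ·Δ[ e ]) j) ⟩
    b j ℤ.- (σ ·Δ[ e ]) j ℤ.- ((ρ ·Δ[ e ]) j ℤ.- (σ ·Δ[ e ]) j) ≡⟨ cong₂ ℤ._-_ (b→c j) (·Δ-distrib-- ρ σ j) ⟨
    c j ℤ.- ((λ k → ρ k ℤ.- σ k) ·Δ[ e ]) j        ∎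
    where
    open ≡-Reasoning
    regroup : ∀ x s r → x ℤ.- r ≡ x ℤ.- s ℤ.- (r ℤ.- s)
    regroup = ℤ-Solver.solve 3 (λ x s r → x :- r := x :- s :- (r :- s)) refl
      where open ℤ-Solver

  fires-onto-summand : ∀ {b c ρ} → Fires (b +ᶜ c) ρ b → ∀ j → (ρ ·Δ[ e ]) j ≡ c j
  fires-onto-summand {b} {c} {ρ} b+c→b j = begin
    (ρ ·Δ[ e ]) j                                      ≡⟨ solve-for-r (b j ℤ.+ c j) ((ρ ·Δ[ e ]) j) ⟩
    b j ℤ.+ c j ℤ.- (b j ℤ.+ c j ℤ.- (ρ ·Δ[ e ]) j)    ≡⟨ cong (ℤ._-_ (b j ℤ.+ c j)) (b+c→b j) ⟨
    b j ℤ.+ c j ℤ.- b j                                ≡⟨ cancel-b (b j) (c j) ⟩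
    c j                                                ∎
    where
    open ≡-Reasoning
    open ℤ-Solver
    solve-for-r : ∀ p r → r ≡ p ℤ.- (p ℤ.- r)
    solve-for-r = solve 2 (λ p r → r := p :- (p :- r)) refl
    cancel-b : ∀ p q → p ℤ.+ q ℤ.- p ≡ q
    cancel-b = solve 2 (λ p q → p :+ q :- p := q) refl

  unit-nonneg : ∀ i → NonNeg (ℤᴿ.unit {n} i)
  unit-nonneg i k with does (i ≟ k)
  ... | true  = ℤ.+≤+ ℕ.z≤n
  ... | false = ℤ.+≤+ ℕ.z≤n

  legal⇒fires : ∀ {b b'} → Legal e b b' → ∃[ τ ] NonNeg τ × Fires b τ b'
  legal⇒fires {b} done = (λ _ → + 0) , (λ _ → ℤP.≤-refl) , fires-zero b
  legal⇒fires {b} (fireThen i _ rest) with legal⇒fires rest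
  ... | τ , τ≥0 , fires = ℤᴿ.unit i +ᶜ τ , (λ k → ℤP.+-mono-≤ (unit-nonneg i k) (τ≥0 k)) ,
                          fires-compose {b} {ℤᴿ.unit i} {fire e b i} {τ} (fire-fires b i) fires

  ·Δ-nonpos-off-support : ∀ ρ → NonNeg ρ → ∀ i → ρ i ≡ + 0 → (ρ ·Δ[ e ]) i ℤ.≤ + 0
  ·Δ-nonpos-off-support ρ ρ≥0 i ρᵢ≡0 = sumℤ-nonpos (λ k → ρ k ℤ.* Δ e k i) term≤0
    where
    term≤0 : ∀ k → ρ k ℤ.* Δ e k i ℤ.≤ + 0
    term≤0 k with k ≟ i
    ... | yes refl = ℤP.≤-reflexive (cong (ℤ._* + outdeg e k) ρᵢ≡0)
    ... | no _     = subst (ρ k ℤ.* ℤ.- (+ e k (inject₁ i)) ℤ.≤_) (ℤP.*-zeroʳ (ρ k))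
                       (ℤP.*-monoˡ-≤-nonNeg (ρ k) {{ℤ.nonNegative (ρ≥0 k)}} (ℤP.neg-mono-≤ (ℤ.+≤+ ℕ.z≤n)))

  least-action : ∀ {b b' s ρ} → Legal e b b' → Stable e s → NonNeg ρ → Fires b ρ s →
                ∃[ ρ' ] NonNeg ρ' × Fires b' ρ' s
  least-action done _ ρ≥0 b→s = _ , ρ≥0 , b→s
  least-action {b} {s = s} {ρ} (fireThen i active rest) stable@(_ , s-stable) ρ≥0 b→s =
    least-action rest stable ρ-uᵢ≥0 (fires-cancel {b} {ℤᴿ.unit i} {fire e b i} {ρ} (fire-fires b i) b→s)
    where
    -- If ρ i = 0 then s i ≥ b i, so i would still be active in the stable s.
    ρᵢ>0 : + 0 ℤ.< ρ i
    ρᵢ>0 with + 0 ℤP.≟ ρ i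
    ... | no 0≢ρᵢ  = ℤP.≤∧≢⇒< (ρ≥0 i) 0≢ρᵢ
    ... | yes 0≡ρᵢ = contradiction (ℤP.≤-trans active bᵢ≤sᵢ) (s-stable i)
      where
      bᵢ≤sᵢ : b i ℤ.≤ s i
      bᵢ≤sᵢ = subst₂ ℤ._≤_ (ℤP.+-identityʳ (b i)) (sym (b→s i))
        (ℤP.+-monoʳ-≤ (b i) (ℤP.neg-mono-≤ (·Δ-nonpos-off-support ρ ρ≥0 i (sym 0≡ρᵢ))))

    ρ-uᵢ≥0 : NonNeg (λ k → ρ k ℤ.- ℤᴿ.unit i k)
    ρ-uᵢ≥0 k with i ≟ k
    ... | yes refl = ℤP.i≤j⇒0≤j-i (ℤP.i<j⇒suc[i]≤j ρᵢ>0)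
    ... | no _     = subst (ℤ._≤_ (+ 0)) (sym (ℤP.+-identityʳ (ρ k))) (ρ≥0 k)

withSink : {A : Set} → A → (Fin n → A) → Fin (ℕ.suc n) → A
withSink {ℕ.zero}  a v _       = a
withSink {ℕ.suc n} a v zero    = v zero
withSink {ℕ.suc n} a v (suc k) = withSink a (v ∘ suc) k

withSink-inject₁ : {A : Set} (a : A) (v : Fin n → A) (j : Fin n) → withSink a v (inject₁ j) ≡ v j
withSink-inject₁ a v zero    = refl
withSink-inject₁ a v (suc j) = withSink-inject₁ a (v ∘ suc) j

withSink-fromℕ : {A : Set} (a : A) (v : Fin n → A) → withSink a v (fromℕ n) ≡ a
withSink-fromℕ {ℕ.zero}  a v = refl
withSink-fromℕ {ℕ.suc n} a v = withSink-fromℕ a (v ∘ suc)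

𝟙[_] : {A : Set} → Dec A → ℚ
𝟙[ yes _ ] = 1ℚ
𝟙[ no _ ]  = 0ℚ

0≤𝟙 : {A : Set} (a? : Dec A) → 0ℚ ℚ.≤ 𝟙[ a? ]
0≤𝟙 (yes _) = ℚP.nonNegative⁻¹ 1ℚ
0≤𝟙 (no _)  = ℚP.≤-refl

𝟙≡1 : {A : Set} (a? : Dec A) → A → 𝟙[ a? ] ≡ 1ℚ
𝟙≡1 (yes _) _ = refl
𝟙≡1 (no ¬a) a = contradiction a ¬a

𝟙≡0 : {A : Set} (a? : Dec A) → ¬ A → 𝟙[ a? ] ≡ 0ℚ
𝟙≡0 (yes a) ¬a = contradiction a ¬a
𝟙≡0 (no _)  _  = refl

weight*[1-𝟙]≤0⇒holds : ∀ {A : Set} (a? : Dec A) {m} → 0 ℕ.< m →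
                        ℚ[ + m ] ℚ.* (1ℚ ℚ.- 𝟙[ a? ]) ℚ.≤ 0ℚ → A
weight*[1-𝟙]≤0⇒holds (yes a) _   _ = a
weight*[1-𝟙]≤0⇒holds (no _) {m} 0<m m*[1-0]≤0 =
  contradiction (ℤP.drop‿+≤+ (ℚ[]-cancel-≤ {+ m} {+ 0} m≤0)) (ℕP.<⇒≱ 0<m)
  where
  m≤0 : ℚ[ + m ] ℚ.≤ 0ℚ
  m≤0 = subst (ℚ._≤ 0ℚ)
    (trans (cong (ℚ._*_ ℚ[ + m ]) {1ℚ ℚ.- 0ℚ} {1ℚ} refl) (ℚP.*-identityʳ ℚ[ + m ])) m*[1-0]≤0

0≤1-𝟙 : {A : Set} (a? : Dec A) → 0ℚ ℚ.≤ 1ℚ ℚ.- 𝟙[ a? ]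
0≤1-𝟙 (yes _) = ℚP.≤-refl
0≤1-𝟙 (no _)  = ℚP.nonNegative⁻¹ 1ℚ

0-𝟙≤0 : {A : Set} (a? : Dec A) → 0ℚ ℚ.- 𝟙[ a? ] ℚ.≤ 0ℚ
0-𝟙≤0 (yes _) = ℚP.nonPositive⁻¹ (ℚ.- 1ℚ)
0-𝟙≤0 (no _)  = ℚP.≤-refl

module _ {n} (e : Edges n) (loopless : Loopless e) where

  Δℚ⊙≡edgeSum : (v̂ : Fin (ℕ.suc n) → ℚ) → v̂ (fromℕ n) ≡ 0ℚ → ∀ i →
    (Δℚ e ℚᴿ.⊙ (v̂ ∘ inject₁)) i ≡ ℚᴿ.sum (λ k → ℚ[ + e i k ] ℚ.* (v̂ (inject₁ i) ℚ.- v̂ k))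
  -- Both sides plus Σⱼ e i j · v j equal outdeg e i · v i.
  Δℚ⊙≡edgeSum v̂ v̂-sink≡0 i = +-cancelʳ inner _ _ (trans lhs+inner (sym rhs+inner))
    where
    open ≡-Reasoning
    v : Fin n → ℚ
    v = v̂ ∘ inject₁
    E : Fin (ℕ.suc n) → ℚ
    E k = ℚ[ + e i k ]
    inner : ℚ
    inner = ℚᴿ.sum (λ j → E (inject₁ j) ℚ.* v j)

    diagonal : ∀ j → Δℚ e i j ℚ.* v j ℚ.+ E (inject₁ j) ℚ.* v j
                     ≡ (if does (i ≟ j) then ℚ[ + outdeg e i ] ℚ.* v j else 0ℚ)
    diagonal j with i ≟ j
    ... | yes refl rewrite loopless i =
      trans (cong (ℚ._+_ (ℚ[ + outdeg e i ] ℚ.* v i)) (ℚP.*-zeroˡ (v i))) (ℚP.+-identityʳ _)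
    ... | no _ rewrite ℚ[]-neg (+ e i (inject₁ j)) = cancel (E (inject₁ j)) (v j)
      where
      cancel : ∀ a x → ℚ.- a ℚ.* x ℚ.+ a ℚ.* x ≡ 0ℚ
      cancel = ℚ-Solver.solve 2 (λ a x → :- a :* x :+ a :* x := con 0ℚ) refl
        where open ℚ-Solver

    lhs+inner : (Δℚ e ℚᴿ.⊙ v) i ℚ.+ inner ≡ ℚ[ + outdeg e i ] ℚ.* v i
    lhs+inner = begin
      (Δℚ e ℚᴿ.⊙ v) i ℚ.+ inner
        ≡⟨ ℚᴿ.∑-distrib-+ (λ j → Δℚ e i j ℚ.* v j) (λ j → E (inject₁ j) ℚ.* v j) ⟨
      ℚᴿ.sum (λ j → Δℚ e i j ℚ.* v j ℚ.+ E (inject₁ j) ℚ.* v j)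
        ≡⟨ ℚᴿ.sum-cong-≋ diagonal ⟩
      ℚᴿ.sum (λ j → if does (i ≟ j) then ℚ[ + outdeg e i ] ℚ.* v j else 0ℚ)
        ≡⟨ ℚᴿ.sum-δ i (λ j → ℚ[ + outdeg e i ] ℚ.* v j) ⟩
      ℚ[ + outdeg e i ] ℚ.* v i ∎

    inner≡ : inner ≡ ℚᴿ.sum (λ k → E k ℚ.* v̂ k)
    inner≡ = sym (begin
      ℚᴿ.sum (λ k → E k ℚ.* v̂ k)                      ≡⟨ ℚᴿ.sum-init-last (λ k → E k ℚ.* v̂ k) ⟩
      inner ℚ.+ E (fromℕ n) ℚ.* v̂ (fromℕ n)          ≡⟨ cong (λ x → inner ℚ.+ E (fromℕ n) ℚ.* x) v̂-sink≡0 ⟩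
      inner ℚ.+ E (fromℕ n) ℚ.* 0ℚ                    ≡⟨ cong (ℚ._+_ inner) (ℚP.*-zeroʳ (E (fromℕ n))) ⟩
      inner ℚ.+ 0ℚ                                    ≡⟨ ℚP.+-identityʳ inner ⟩
      inner                                           ∎)

    rhs+inner : ℚᴿ.sum (λ k → E k ℚ.* (v i ℚ.- v̂ k)) ℚ.+ inner ≡ ℚ[ + outdeg e i ] ℚ.* v i
    rhs+inner = begin
      ℚᴿ.sum (λ k → E k ℚ.* (v i ℚ.- v̂ k)) ℚ.+ inner
        ≡⟨ cong (ℚ._+_ (ℚᴿ.sum (λ k → E k ℚ.* (v i ℚ.- v̂ k)))) inner≡ ⟩
      ℚᴿ.sum (λ k → E k ℚ.* (v i ℚ.- v̂ k)) ℚ.+ ℚᴿ.sum (λ k → E k ℚ.* v̂ k)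
        ≡⟨ ℚᴿ.∑-distrib-+ (λ k → E k ℚ.* (v i ℚ.- v̂ k)) (λ k → E k ℚ.* v̂ k) ⟨
      ℚᴿ.sum (λ k → E k ℚ.* (v i ℚ.- v̂ k) ℚ.+ E k ℚ.* v̂ k)
        ≡⟨ ℚᴿ.sum-cong-≋ (λ k → telescope (E k) (v i) (v̂ k)) ⟩
      ℚᴿ.sum (λ k → E k ℚ.* v i)
        ≡⟨ ℚᴿ.*-distribʳ-sum (v i) E ⟨
      ℚᴿ.sum E ℚ.* v i
        ≡⟨ cong (ℚ._* v i) (ℚ[]-sumℕ (e i)) ⟨
      ℚ[ + outdeg e i ] ℚ.* v i ∎
      where
      telescope : ∀ a x y → a ℚ.* (x ℚ.- y) ℚ.+ a ℚ.* y ≡ a ℚ.* x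
      telescope = ℚ-Solver.solve 3 (λ a x y → a :* (x :- y) :+ a :* y := a :* x) refl
        where open ℚ-Solver

reachesSink-avoids : ∀ {n} (e : Edges n) {P : Fin (ℕ.suc n) → Set} → ¬ P (fromℕ n) →
                     (∀ i k → P (inject₁ i) → 0 ℕ.< e i k → P k) → ∀ {v} → ReachesSink e v → ¬ P v
reachesSink-avoids e ¬P-sink closed atSink = ¬P-sink
reachesSink-avoids e ¬P-sink closed (step i k eᵢₖ>0 k↝sink) Pᵢ =
  reachesSink-avoids e ¬P-sink closed k↝sink (closed i k Pᵢ eᵢₖ>0)

*-nonneg : ∀ {p q} → 0ℚ ℚ.≤ p → 0ℚ ℚ.≤ q → 0ℚ ℚ.≤ p ℚ.* q
*-nonneg {p} {q} 0≤p 0≤q =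
  ℚP.nonNegative⁻¹ _ {{ℚP.nonNeg*nonNeg⇒nonNeg p {{ℚ.nonNegative 0≤p}} q {{ℚ.nonNegative 0≤q}}}}

*-nonpos-nonneg : ∀ {p q} → p ℚ.≤ 0ℚ → 0ℚ ℚ.≤ q → p ℚ.* q ℚ.≤ 0ℚ
*-nonpos-nonneg {p} {q} p≤0 0≤q =
  ℚP.nonPositive⁻¹ _ {{ℚP.nonPos*nonNeg⇒nonPos p {{ℚ.nonPositive p≤0}} q {{ℚ.nonNegative 0≤q}}}}

*-nonneg-nonpos : ∀ {p q} → 0ℚ ℚ.≤ p → q ℚ.≤ 0ℚ → p ℚ.* q ℚ.≤ 0ℚ
*-nonneg-nonpos {p} {q} 0≤p q≤0 =
  ℚP.nonPositive⁻¹ _ {{ℚP.nonNeg*nonPos⇒nonPos p {{ℚ.nonNegative 0≤p}} q {{ℚ.nonPositive q≤0}}}}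

-- For the indicator χ of S = {u < 0}, (Δχ)ᵢ is the number of edges leaving S at i ∈ S and minus
-- the number entering S at i ∉ S (the sink has energy 0, so lies outside S). Hence every term of
-- Σᵢ uᵢ (Δχ)ᵢ = Σⱼ (uΔ)ⱼ χⱼ ≥ 0 is ≤ 0, which forces (Δχ)ᵢ = 0 on S: no edge leaves S.
module NegativeVertices {n} (e : Edges n) (loopless : Loopless e)
                        (u : Fin n → ℚ) (uΔ≥0 : ∀ j → 0ℚ ℚ.≤ (u ·Δℚ[ e ]) j) where

  û : Fin (ℕ.suc n) → ℚ
  û = withSink 0ℚ u

  χ̂ : Fin (ℕ.suc n) → ℚ
  χ̂ k = 𝟙[ û k ℚP.<? 0ℚ ]

  û-sink≮0 : ¬ û (fromℕ n) ℚ.< 0ℚ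
  û-sink≮0 û<0 = ℚP.<-irrefl refl (subst (ℚ._< 0ℚ) (withSink-fromℕ 0ℚ u) û<0)

  χ̂-sink : χ̂ (fromℕ n) ≡ 0ℚ
  χ̂-sink = 𝟙≡0 (û (fromℕ n) ℚP.<? 0ℚ) û-sink≮0

  W : Fin n → ℚ
  W = Δℚ e ℚᴿ.⊙ (χ̂ ∘ inject₁)

  edgeTerm : Fin n → Fin (ℕ.suc n) → ℚ
  edgeTerm i k = ℚ[ + e i k ] ℚ.* (χ̂ (inject₁ i) ℚ.- χ̂ k)

  W≡edgeSum : ∀ i → W i ≡ ℚᴿ.sum (edgeTerm i)
  W≡edgeSum = Δℚ⊙≡edgeSum e loopless χ̂ χ̂-sink

  0≤edge : ∀ i k → 0ℚ ℚ.≤ ℚ[ + e i k ]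
  0≤edge i k = ℚ[]-mono-≤ {+ 0} {+ e i k} (ℤ.+≤+ ℕ.z≤n)

  edgeTerm-nonneg : ∀ i → û (inject₁ i) ℚ.< 0ℚ → ∀ k → 0ℚ ℚ.≤ edgeTerm i k
  edgeTerm-nonneg i ûᵢ<0 k = *-nonneg (0≤edge i k)
    (subst (λ c → 0ℚ ℚ.≤ c ℚ.- χ̂ k) (sym (𝟙≡1 (û (inject₁ i) ℚP.<? 0ℚ) ûᵢ<0)) (0≤1-𝟙 (û k ℚP.<? 0ℚ)))

  edgeTerm-nonpos : ∀ i → ¬ û (inject₁ i) ℚ.< 0ℚ → ∀ k → edgeTerm i k ℚ.≤ 0ℚ
  edgeTerm-nonpos i ûᵢ≮0 k = *-nonneg-nonpos (0≤edge i k)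
    (subst (λ c → c ℚ.- χ̂ k ℚ.≤ 0ℚ) (sym (𝟙≡0 (û (inject₁ i) ℚP.<? 0ℚ) ûᵢ≮0)) (0-𝟙≤0 (û k ℚP.<? 0ℚ)))

  W-nonneg : ∀ i → û (inject₁ i) ℚ.< 0ℚ → 0ℚ ℚ.≤ W i
  W-nonneg i ûᵢ<0 = subst (0ℚ ℚ.≤_) (sym (W≡edgeSum i)) (sum-nonneg (edgeTerm-nonneg i ûᵢ<0))

  W-nonpos : ∀ i → ¬ û (inject₁ i) ℚ.< 0ℚ → W i ℚ.≤ 0ℚ
  W-nonpos i ûᵢ≮0 = subst (ℚ._≤ 0ℚ) (sym (W≡edgeSum i)) (sum-nonpos (edgeTerm-nonpos i ûᵢ≮0))

  ûᵢ≡uᵢ : ∀ i → û (inject₁ i) ≡ u i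
  ûᵢ≡uᵢ = withSink-inject₁ 0ℚ u

  u*W≤0 : ∀ i → u i ℚ.* W i ℚ.≤ 0ℚ
  u*W≤0 i with u i ℚP.<? 0ℚ
  ... | yes uᵢ<0 = *-nonpos-nonneg (ℚP.<⇒≤ uᵢ<0) (W-nonneg i (subst (ℚ._< 0ℚ) (sym (ûᵢ≡uᵢ i)) uᵢ<0))
  ... | no uᵢ≮0  = *-nonneg-nonpos (ℚP.≮⇒≥ uᵢ≮0) (W-nonpos i (uᵢ≮0 ∘ subst (ℚ._< 0ℚ) (ûᵢ≡uᵢ i)))

  0≤∑u*W : 0ℚ ℚ.≤ ℚᴿ.sum (λ i → u i ℚ.* W i)
  0≤∑u*W = subst (0ℚ ℚ.≤_) (ℚᴿ.⊛-⊙-assoc u (Δℚ e) (χ̂ ∘ inject₁))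
    (sum-nonneg (λ j → *-nonneg (subst (0ℚ ℚ.≤_) (·Δℚ≡⊛ e u j) (uΔ≥0 j)) (0≤𝟙 (û (inject₁ j) ℚP.<? 0ℚ))))

  W≤0 : ∀ i → u i ℚ.< 0ℚ → W i ℚ.≤ 0ℚ
  W≤0 i uᵢ<0 = ℚP.*-cancelˡ-≤-neg (u i) {{ℚ.negative uᵢ<0}}
    (subst (ℚ._≤ u i ℚ.* W i) (sym (ℚP.*-zeroʳ (u i))) (ℚP.≤-trans 0≤∑u*W (sum≤term u*W≤0 i)))

  closed : ∀ i k → û (inject₁ i) ℚ.< 0ℚ → 0 ℕ.< e i k → û k ℚ.< 0ℚ
  closed i k ûᵢ<0 eᵢₖ>0 = weight*[1-𝟙]≤0⇒holds (û k ℚP.<? 0ℚ) eᵢₖ>0 (ℚP.≤-trans termₖ≤W (W≤0 i uᵢ<0))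
    where
    uᵢ<0 : u i ℚ.< 0ℚ
    uᵢ<0 = subst (ℚ._< 0ℚ) (ûᵢ≡uᵢ i) ûᵢ<0
    termₖ≤W : ℚ[ + e i k ] ℚ.* (1ℚ ℚ.- χ̂ k) ℚ.≤ W i
    termₖ≤W = subst₂ ℚ._≤_ (cong (λ c → ℚ[ + e i k ] ℚ.* (c ℚ.- χ̂ k)) (𝟙≡1 (û (inject₁ i) ℚP.<? 0ℚ) ûᵢ<0))
                          (sym (W≡edgeSum i)) (term≤sum (edgeTerm-nonneg i ûᵢ<0) k)

·Δℚ-nonneg⇒nonneg : ∀ {n} (e : Edges n) → Loopless e → GlobalSink e →
                    ∀ u → (∀ j → 0ℚ ℚ.≤ (u ·Δℚ[ e ]) j) → ∀ i → 0ℚ ℚ.≤ u i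
·Δℚ-nonneg⇒nonneg e loopless sink u uΔ≥0 i =
  ℚP.≮⇒≥ (λ uᵢ<0 → reachesSink-avoids e û-sink≮0 closed (sink i) (subst (ℚ._< 0ℚ) (sym (ûᵢ≡uᵢ i)) uᵢ<0))
  where open NegativeVertices e loopless u uΔ≥0

·Δ-nonneg⇒nonneg : ∀ {n} (e : Edges n) → Loopless e → GlobalSink e →
                   ∀ ρ → (∀ j → + 0 ℤ.≤ (ρ ·Δ[ e ]) j) → NonNeg ρ
·Δ-nonneg⇒nonneg e loopless sink ρ ρΔ≥0 i = ℚ[]-cancel-≤ {+ 0} {ρ i}
  (·Δℚ-nonneg⇒nonneg e loopless sink (toℚ ρ) (λ j → subst (0ℚ ℚ.≤_) (toℚ-·Δ e ρ j) (ℚ[]-mono-≤ (ρΔ≥0 j))) i)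

fires⇒energy-≼ : ∀ {n} (e : Edges n) → Loopless e → GlobalSink e →
                 ∀ {b ρ s x y} → Fires e b ρ s → NonNeg ρ → IsEnergy e s x → IsEnergy e b y → x ≼ y
fires⇒energy-≼ e loopless sink {b} {ρ} {s} {x} {y} b→s ρ≥0 x-energy y-energy i =
  subst₂ ℚ._≤_ (ℚP.+-identityʳ (x i)) (x+[r+w]≡y (x i) (y i) ℚ[ ρ i ])
    (ℚP.+-monoʳ-≤ (x i) (ℚP.+-mono-≤ (ℚ[]-mono-≤ (ρ≥0 i)) (w≥0 i)))
  where
  w : Fin _ → ℚ
  w k = y k ℚ.- x k ℚ.- ℚ[ ρ k ]

  wΔ≡0 : ∀ j → (w ·Δℚ[ e ]) j ≡ 0ℚ
  wΔ≡0 j = begin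
    (w ·Δℚ[ e ]) j
      ≡⟨ ·Δℚ-distrib-- e (λ k → y k ℚ.- x k) (toℚ ρ) j ⟩
    ((λ k → y k ℚ.- x k) ·Δℚ[ e ]) j ℚ.- (toℚ ρ ·Δℚ[ e ]) j
      ≡⟨ cong₂ ℚ._-_ (·Δℚ-distrib-- e y x j) (sym (toℚ-·Δ e ρ j)) ⟩
    (y ·Δℚ[ e ]) j ℚ.- (x ·Δℚ[ e ]) j ℚ.- ℚ[ (ρ ·Δ[ e ]) j ]
      ≡⟨ cong₂ (λ p q → p ℚ.- q ℚ.- ℚ[ (ρ ·Δ[ e ]) j ]) (y-energy j) (x-energy j) ⟩
    ℚ[ b j ] ℚ.- ℚ[ s j ] ℚ.- ℚ[ (ρ ·Δ[ e ]) j ]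
      ≡⟨ trans (ℚ[]-- (b j ℤ.- s j) _) (cong (ℚ._- ℚ[ (ρ ·Δ[ e ]) j ]) (ℚ[]-- (b j) (s j))) ⟨
    ℚ[ b j ℤ.- s j ℤ.- (ρ ·Δ[ e ]) j ]
      ≡⟨ cong (λ t → ℚ[ b j ℤ.- t ℤ.- (ρ ·Δ[ e ]) j ]) (b→s j) ⟩
    ℚ[ b j ℤ.- (b j ℤ.- (ρ ·Δ[ e ]) j) ℤ.- (ρ ·Δ[ e ]) j ]
      ≡⟨ cong ℚ[_] (cancel (b j) ((ρ ·Δ[ e ]) j)) ⟩
    0ℚ ∎
    where
    open ≡-Reasoning
    cancel : ∀ p r → p ℤ.- (p ℤ.- r) ℤ.- r ≡ + 0
    cancel = ℤ-Solver.solve 2 (λ p r → p :- (p :- r) :- r := con (+ 0)) refl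
      where open ℤ-Solver

  w≥0 : ∀ k → 0ℚ ℚ.≤ w k
  w≥0 = ·Δℚ-nonneg⇒nonneg e loopless sink w (λ j → ℚP.≤-reflexive (sym (wΔ≡0 j)))

  x+[r+w]≡y : ∀ p q r → p ℚ.+ (r ℚ.+ (q ℚ.- p ℚ.- r)) ≡ q
  x+[r+w]≡y = ℚ-Solver.solve 3 (λ p q r → p :+ (r :+ (q :- p :- r)) := q) refl
    where open ℚ-Solver

theorem3 : ∀ (n : ℕ) (e : Edges n) → Loopless e → GlobalSink e →
    ∀ (aStar : Config n) → Critical e aStar →
    ∀ (a : Config n) → Stable e a → LinEquiv e aStar a →
    ∀ (x y : Fin n → ℚ) → IsEnergy e a x → IsEnergy e aStar y →
    (x ≼ y) × (¬ (∀ i → a i ≡ aStar i) → x ≢ y)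
theorem3 n e loopless sink aStar (_ , aStar-critical) a a-stable (σ , aStar→a) x y x-energy y-energy
  with aStar-critical a
... | c , c≥0 , _ , legal , _ with legal⇒fires e legal
... | τ , _ , [a+c]→aStar = energy-≼ , energy-≢
  where
  [a+c]→a : Fires e (a +ᶜ c) (τ +ᶜ σ) a
  [a+c]→a = fires-compose e {a +ᶜ c} {τ} {aStar} {σ} [a+c]→aStar aStar→a

  τ+σ≥0 : NonNeg (τ +ᶜ σ)
  τ+σ≥0 = ·Δ-nonneg⇒nonneg e loopless sink (τ +ᶜ σ)
    (λ j → subst (ℤ._≤_ (+ 0)) (sym (fires-onto-summand e {a} {c} {τ +ᶜ σ} [a+c]→a j)) (c≥0 j))

  energy-≼ : x ≼ y
  energy-≼ =
    let σ' , σ'≥0 , aStar→a' = least-action e legal a-stable τ+σ≥0 [a+c]→a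
    in fires⇒energy-≼ e loopless sink {aStar} aStar→a' σ'≥0 x-energy y-energy

  energy-≢ : ¬ (∀ i → a i ≡ aStar i) → x ≢ y
  energy-≢ a≢aStar refl = a≢aStar (λ i → ℚ[]-injective (trans (sym (x-energy i)) (y-energy i)))
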